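{- Let $G$ be a graph, let $Q$ be a clique of $G$ with $q\ge 1$ vertices, and let $G'$ be the graph obtained from $G$ by adding a new vertex $v$ adjacent to exactly the vertices of $Q$. If $G$ is fully orientable, then $G'$ is fully orientable.
   Context: All graphs are finite, without loops or multiple edges. A clique is a set of pairwise adjacent vertices. An orientation of $G$ assigns a direction to each edge; it is acyclic if it contains no directed cycle. In an acyclic orientation $D$, an arc is called dependent if reversing it creates a directed cycle. $d(D)$ is the number of dependent arcs of $D$; $d_{\min}(G)$ and $d_{\max}(G)$ are the minimum and maximum of $d(D)$ over all acyclic orientations $D$ of $G$. $G$ is fully orientable if for every integer $d$ with $d_{\min}(G)\le d\le d_{\max}(G)$ there is an acyclic orientation $D$ of $G$ with $d(D)=d$. -}

module Defs where

open import Data.Nat using (ℕ; zero; suc; _≤_)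
open import Data.Bool using (Bool; true; false; not; if_then_else_; _∧_)
open import Data.Fin using (Fin; zero; suc; _≟_)
open import Data.Fin.Subset using (Subset; _∈_)
open import Data.Vec using (lookup)
open import Data.Product using (Σ; ∃; _×_; _,_)
open import Data.List using (List; length)
open import Data.List.Membership.Propositional using () renaming (_∈_ to _∈L_)
open import Data.List.Relation.Unary.All using (All)
open import Data.List.Relation.Unary.Unique.Propositional using (Unique)
open import Relation.Nullary using (¬_; yes; no)
open import Relation.Binary.PropositionalEquality using (_≡_; _≢_; refl)

record Graph (n : ℕ) : Set where
  field
    adj    : Fin n → Fin n → Bool
    sym    : ∀ u v → adj u v ≡ adj v u
    irrefl : ∀ u → adj u u ≡ false

open Graph public

Edge : ∀ {n} → Graph n → Fin n → Fin n → Set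
Edge G u v = adj G u v ≡ true

-- An orientation: for every edge {u,v} exactly one of (u,v),(v,u) is an arc.
-- (Values of dir on non-edges are irrelevant: arcs are only taken on edges.)
record Orientation {n : ℕ} (G : Graph n) : Set where
  field
    dir     : Fin n → Fin n → Bool
    dirEdge : ∀ u v → Edge G u v → dir u v ≡ not (dir v u)

open Orientation public

Arc : ∀ {n} {G : Graph n} → Orientation G → Fin n → Fin n → Set
Arc {G = G} D u v = Edge G u v × dir D u v ≡ true

data Path {n} {G : Graph n} (D : Orientation G) : Fin n → Fin n → Set where
  step : ∀ {u v} → Arc D u v → Path D u v
  _∷_  : ∀ {u w v} → Arc D u w → Path D w v → Path D u v

Acyclic : ∀ {n} {G : Graph n} → Orientation G → Set
Acyclic D = ∀ u → ¬ Path D u u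

private
  eqB : ∀ {n} → Fin n → Fin n → Bool
  eqB a b with a ≟ b
  ... | yes _ = true
  ... | no  _ = false

reverse : ∀ {n} {G : Graph n} → Orientation G → Fin n → Fin n → Orientation G
reverse {n} {G} D u v = record { dir = d' ; dirEdge = pf }
  where
  d' : Fin n → Fin n → Bool
  d' x y = if eqB x u ∧ eqB y v then false
           else if eqB x v ∧ eqB y u then true
           else dir D x y
  pf : ∀ x y → Edge G x y → d' x y ≡ not (d' y x)
  pf x y e with x ≟ u | y ≟ v | x ≟ v | y ≟ u
  ... | yes refl | yes refl | yes refl | _ rewrite irrefl G x with e
  ...   | ()
  pf x y e | yes refl | yes refl | no _ | yes refl rewrite irrefl G x with e
  ...   | ()
  pf x y e | yes refl | yes refl | no _ | no _ = refl
  pf x y e | yes refl | no _ | yes refl | yes refl rewrite irrefl G x with e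
  ...   | ()
  pf x y e | yes refl | no _ | yes refl | no _ = dirEdge D x y e
  pf x y e | yes refl | no _ | no _ | yes refl rewrite irrefl G x with e
  ...   | ()
  pf x y e | yes refl | no _ | no _ | no _ = dirEdge D x y e
  pf x y e | no _ | yes refl | yes refl | yes refl rewrite irrefl G x with e
  ...   | ()
  pf x y e | no _ | yes refl | yes refl | no _ = dirEdge D x y e
  pf x y e | no _ | yes refl | no _ | yes refl = dirEdge D x y e
  pf x y e | no _ | yes refl | no _ | no _ = dirEdge D x y e
  pf x y e | no _ | no _ | yes refl | yes refl = refl
  pf x y e | no _ | no _ | yes refl | no _ = dirEdge D x y e
  pf x y e | no _ | no _ | no _ | yes refl = dirEdge D x y e
  pf x y e | no _ | no _ | no _ | no _ = dirEdge D x y e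

Dependent : ∀ {n} {G : Graph n} → Orientation G → Fin n × Fin n → Set
Dependent D (u , v) = Arc D u v × ¬ Acyclic (reverse D u v)

NumDep : ∀ {n} {G : Graph n} → Orientation G → ℕ → Set
NumDep {n} D k = Σ (List (Fin n × Fin n)) λ L →
  Unique L × All (Dependent D) L × (∀ p → Dependent D p → p ∈L L) × length L ≡ k

Achieves : ∀ {n} → Graph n → ℕ → Set
Achieves G k = Σ (Orientation G) λ D → Acyclic D × NumDep D k

IsDmin : ∀ {n} → Graph n → ℕ → Set
IsDmin G m = Achieves G m × (∀ k → Achieves G k → m ≤ k)

IsDmax : ∀ {n} → Graph n → ℕ → Set
IsDmax G M = Achieves G M × (∀ k → Achieves G k → k ≤ M)

FullyOrientable : ∀ {n} → Graph n → Set
FullyOrientable G = ∀ m M → IsDmin G m → IsDmax G M →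
  ∀ d → m ≤ d → d ≤ M → Achieves G d

IsClique : ∀ {n} → Graph n → Subset n → Set
IsClique G Q = ∀ u v → u ∈ Q → v ∈ Q → u ≢ v → Edge G u v

-- G' : add a new vertex (index zero; old vertex i becomes suc i)
-- adjacent to exactly the vertices of Q
addVertex : ∀ {n} → Graph n → Subset n → Graph (suc n)
addVertex {n} G Q = record { adj = a ; sym = s ; irrefl = ir }
  where
  a : Fin (suc n) → Fin (suc n) → Bool
  a zero zero = false
  a zero (suc j) = lookup Q j
  a (suc i) zero = lookup Q i
  a (suc i) (suc j) = adj G i j
  s : ∀ u v → a u v ≡ a v u
  s zero zero = refl
  s zero (suc j) = refl
  s (suc i) zero = refl
  s (suc i) (suc j) = sym G i j
  ir : ∀ u → a u u ≡ false
  ir zero = refl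
  ir (suc i) = irrefl G i

-- Let D′ be an acyclic orientation of G′ and D its restriction to G. The arcs at the new vertex v
-- split Q into in-neighbours A and out-neighbours B. Since Q is a clique, D orders Q linearly, and
-- an arc x → v (v → x) is dependent iff x is not the last vertex of A (not the first of B). An old
-- arc can only become dependent through a detour via v, and every such detour can be rerouted
-- along the arc from the last vertex of A to the first of B, so at most that arc is new. Hence
-- d(D) + q − 2 ≤ d(D′) ≤ d(D) + q − 1, with equality on the right when v is a source. For
-- d_min(G′) < d ≤ d_max(G′) these bounds place d + 1 − q in [d_min(G), d_max(G)]; an orientation
-- of G attaining it, extended by the source v, attains d. Constructively, d_min(G) and d_max(G)
-- exist because attainability of a value is decidable, by searching all orientations.
module Submission where

open import Level using (0ℓ)
open import Defs hiding (sym)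
open import Data.Bool using (Bool; true; false; not)
open import Data.Fin.Subset using (Subset; _∈_)
open import Data.Fin.Subset.Properties using (anySubset?)
import Data.Vec as Vec
import Data.Vec.Properties as Vecₚ
import Data.Bool.Properties as Boolₚ
open import Data.Nat as ℕ using (ℕ; zero; suc; _+_; _∸_; _≤_; _<_; z≤n; s≤s)
import Data.Nat.Properties as ℕₚ
open import Data.Fin as Fin using (Fin; zero; suc; toℕ; _≟_)
import Data.Fin.Properties as Finₚ
open import Data.Fin.Properties using (suc-injective)
open import Data.Product using (Σ; ∃; ∃-syntax; _×_; _,_; proj₁; proj₂; uncurry)
open import Data.Product.Properties using (≡-dec)
open import Data.Sum using (_⊎_; inj₁; inj₂)
import Data.Sum
open import Data.Empty using (⊥-elim)
open import Function using (_∘_; case_of_)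
open import Data.Nat.Tactic.RingSolver using (solve-∀)
open import Data.List using (List; []; _∷_; length; filter; cartesianProduct; allFin)
open import Data.List.Membership.Propositional.Properties using (∈-filter⁺; ∈-filter⁻; ∈-cartesianProduct⁺; ∈-allFin)
import Data.List.Relation.Unary.Unique.Propositional.Properties as Uniqueₚ
open import Data.List.Relation.Unary.All as All using (All)
open import Data.List.Relation.Unary.Any using (here; there)
import Data.List.Membership.DecPropositional as Membership
open import Data.List.Membership.Propositional using () renaming (_∈_ to _∈L_)
open import Data.List.Relation.Unary.Unique.Propositional using (Unique)
open import Data.List.Relation.Unary.AllPairs using (_∷_)
open import Relation.Nullary using (¬_; Dec; yes; no)
open import Relation.Nullary.Decidable using (map′; _×-dec_; _⊎-dec_; _→-dec_; ¬?; does; dec-true; dec-false)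
open import Relation.Binary using (Rel; Decidable; tri<; tri≈; tri>)
open import Relation.Binary.Construct.Closure.Transitive using (TransClosure; [_]; _∷_)
open import Relation.Binary.Construct.Closure.ReflexiveTransitive using (Star; ε; _◅_; _◅◅_)
open import Relation.Binary.PropositionalEquality
  using (_≡_; _≢_; refl; sym; trans; cong; cong₂; subst; module ≡-Reasoning)
open import Algebra.Properties.CommutativeMonoid.Sum ℕₚ.+-0-commutativeMonoid
  using (sum; sum-cong-≗; ∑-distrib-+; sum-replicate-zero)

indicator : ∀ {p} {P : Set p} → Dec P → ℕ
indicator (yes _) = 1
indicator (no _)  = 0

indicator-yes : ∀ {p} {P : Set p} (P? : Dec P) → P → indicator P? ≡ 1
indicator-yes (yes _) _  = refl
indicator-yes (no ¬p) p  = ⊥-elim (¬p p)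

indicator-no : ∀ {p} {P : Set p} (P? : Dec P) → ¬ P → indicator P? ≡ 0
indicator-no (yes p) ¬p = ⊥-elim (¬p p)
indicator-no (no _)  _  = refl

indicator≥1 : ∀ {p} {P : Set p} (P? : Dec P) → P → 1 ≤ indicator P?
indicator≥1 P? p = ℕₚ.≤-reflexive (sym (indicator-yes P? p))

indicator-mono : ∀ {p q} {P : Set p} {Q : Set q} (P? : Dec P) (Q? : Dec Q) →
                 (P → Q) → indicator P? ≤ indicator Q?
indicator-mono (yes p) (yes _) _ = ℕₚ.≤-refl
indicator-mono (yes p) (no ¬q) f = ⊥-elim (¬q (f p))
indicator-mono (no _)  _       _ = z≤n

indicator-cong : ∀ {p q} {P : Set p} {Q : Set q} (P? : Dec P) (Q? : Dec Q) →
                 (P → Q) → (Q → P) → indicator P? ≡ indicator Q?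
indicator-cong P? Q? f g = ℕₚ.≤-antisym (indicator-mono P? Q? f) (indicator-mono Q? P? g)

indicator≤1 : ∀ {p} {P : Set p} (P? : Dec P) → indicator P? ≤ 1
indicator≤1 (yes _) = ℕₚ.≤-refl
indicator≤1 (no _)  = z≤n

sum-mono-≤ : ∀ {n} {f g : Fin n → ℕ} → (∀ i → f i ≤ g i) → sum f ≤ sum g
sum-mono-≤ {zero}  f≤g = z≤n
sum-mono-≤ {suc n} f≤g = ℕₚ.+-mono-≤ (f≤g zero) (sum-mono-≤ (f≤g ∘ suc))

sum-zero : ∀ {n} (f : Fin n → ℕ) → (∀ i → f i ≡ 0) → sum f ≡ 0
sum-zero {n} f f≡0 = trans (sum-cong-≗ f≡0) (sum-replicate-zero n)

sum-single : ∀ {n} (f : Fin n → ℕ) (a : Fin n) → (∀ i → i ≢ a → f i ≡ 0) → sum f ≡ f a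
sum-single {suc n} f zero    f≡0 = trans (cong (f zero +_) (sum-zero (f ∘ suc) (λ i → f≡0 (suc i) (λ ()))))
                                         (ℕₚ.+-identityʳ (f zero))
sum-single {suc n} f (suc a) f≡0 = trans (cong (_+ sum (f ∘ suc)) (f≡0 zero (λ ())))
                                         (sum-single (f ∘ suc) a (λ i i≢a → f≡0 (suc i) (i≢a ∘ suc-injective)))

≤-sum : ∀ {n} (f : Fin n → ℕ) (a : Fin n) → f a ≤ sum f
≤-sum f zero    = ℕₚ.m≤m+n (f zero) _
≤-sum f (suc a) = ℕₚ.≤-trans (≤-sum (f ∘ suc) a) (ℕₚ.m≤n+m _ (f zero))

count-≡ : ∀ {n} (a : Fin n) → sum (λ i → indicator (i ≟ a)) ≡ 1
count-≡ a = trans (sum-single _ a (λ i i≢a → indicator-no (i ≟ a) i≢a)) (indicator-yes (a ≟ a) refl)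

Pair : ℕ → Set
Pair n = Fin n × Fin n

_≟²_ : ∀ {n} (p q : Pair n) → Dec (p ≡ q)
_≟²_ = ≡-dec _≟_ _≟_

sum² : ∀ {n} → (Pair n → ℕ) → ℕ
sum² f = sum (λ u → sum (λ w → f (u , w)))

sum²-cong : ∀ {n} {f g : Pair n → ℕ} → (∀ p → f p ≡ g p) → sum² f ≡ sum² g
sum²-cong f≡g = sum-cong-≗ (λ u → sum-cong-≗ (λ w → f≡g (u , w)))

sum²-mono-≤ : ∀ {n} {f g : Pair n → ℕ} → (∀ p → f p ≤ g p) → sum² f ≤ sum² g
sum²-mono-≤ f≤g = sum-mono-≤ (λ u → sum-mono-≤ (λ w → f≤g (u , w)))

sum²-distrib-+ : ∀ {n} (f g : Pair n → ℕ) → sum² (λ p → f p + g p) ≡ sum² f + sum² g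
sum²-distrib-+ f g = trans (sum-cong-≗ (λ u → ∑-distrib-+ (λ w → f (u , w)) (λ w → g (u , w))))
                           (∑-distrib-+ (λ u → sum (λ w → f (u , w))) (λ u → sum (λ w → g (u , w))))

_∈?_ : ∀ {n} (p : Pair n) (L : List (Pair n)) → Dec (p ∈L L)
p ∈? L = Membership._∈?_ _≟²_ p L

count²-≡ : ∀ {n} (a : Pair n) → sum² (λ p → indicator (p ≟² a)) ≡ 1
count²-≡ (a , b) =
  trans (sum-single _ a (λ u u≢a → sum-zero _ (λ w → indicator-no ((u , w) ≟² (a , b)) (u≢a ∘ cong proj₁))))
        (trans (sum-cong-≗ (λ w → indicator-cong ((a , w) ≟² (a , b)) (w ≟ b) (cong proj₂) (cong (a ,_))))
               (count-≡ b))

length-unique : ∀ {n} (L : List (Pair n)) → Unique L → length L ≡ sum² (λ p → indicator (p ∈? L))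
length-unique {n} [] _ =
  sym (sum-zero {n} _ (λ u → sum-zero {n} _ (λ w → indicator-no ((u , w) ∈? []) λ ())))
length-unique (a ∷ L) (a∉L ∷ unique) = begin
  suc (length L)
    ≡⟨ cong₂ _+_ (sym (count²-≡ a)) (length-unique L unique) ⟩
  sum² (λ p → indicator (p ≟² a)) + sum² (λ p → indicator (p ∈? L))
    ≡⟨ sym (sum²-distrib-+ (λ p → indicator (p ≟² a)) _) ⟩
  sum² (λ p → indicator (p ≟² a) + indicator (p ∈? L))
    ≡⟨ sum²-cong (λ p → split p (p ≟² a)) ⟩
  sum² (λ p → indicator (p ∈? (a ∷ L))) ∎
  where
  open ≡-Reasoning
  split : ∀ p (p≟a : Dec (p ≡ a)) → indicator p≟a + indicator (p ∈? L) ≡ indicator (p ∈? (a ∷ L))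
  split p (yes refl) = trans (cong suc (indicator-no (p ∈? L) (λ p∈L → All.lookup a∉L p∈L refl)))
                             (sym (indicator-yes (p ∈? (a ∷ L)) (here refl)))
  split p (no p≢a)   = indicator-cong (p ∈? L) (p ∈? (a ∷ L)) there
                                      (λ { (here p≡a) → ⊥-elim (p≢a p≡a) ; (there p∈L) → p∈L })

module _ {P : ℕ → Set} (P? : ∀ k → Dec (P k)) where

  Least Greatest : ℕ → Set
  Least m    = P m × (∀ k → P k → m ≤ k)
  Greatest m = P m × (∀ k → P k → k ≤ m)

  private
    least-below : ∀ b → ∃ Least ⊎ (∀ k → k < b → ¬ P k)
    least-below zero = inj₂ (λ _ ())
    least-below (suc b) with least-below b
    ... | inj₁ found = inj₁ found
    ... | inj₂ none with P? b
    ...   | yes pb = inj₁ (b , pb , λ k pk → ℕₚ.≮⇒≥ (λ k<b → none k k<b pk))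
    ...   | no ¬pb = inj₂ λ k k<1+b → case ℕₚ.m<1+n⇒m<n∨m≡n k<1+b of λ
                        { (inj₁ k<b) → none k k<b ; (inj₂ refl) → ¬pb }

    greatest-below : ∀ b → (∃ λ m → P m × (∀ k → k < b → P k → k ≤ m)) ⊎ (∀ k → k < b → ¬ P k)
    greatest-below zero = inj₂ (λ _ ())
    greatest-below (suc b) with P? b | greatest-below b
    ... | yes pb | _                  = inj₁ (b , pb , λ _ k<1+b _ → ℕₚ.≤-pred k<1+b)
    ... | no ¬pb | inj₁ (m , pm , max) = inj₁ (m , pm , λ k k<1+b pk → case ℕₚ.m<1+n⇒m<n∨m≡n k<1+b of λ
                                            { (inj₁ k<b) → max k k<b pk ; (inj₂ refl) → ⊥-elim (¬pb pk) })
    ... | no ¬pb | inj₂ none           = inj₂ λ k k<1+b → case ℕₚ.m<1+n⇒m<n∨m≡n k<1+b of λ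
                                            { (inj₁ k<b) → none k k<b ; (inj₂ refl) → ¬pb }

  least : ∀ {k} → P k → ∃ Least
  least {k} pk with least-below (suc k)
  ... | inj₁ found = found
  ... | inj₂ none  = ⊥-elim (none k ℕₚ.≤-refl pk)

  greatest : ∀ {b} → (∀ {k} → P k → k ≤ b) → ∀ {k} → P k → ∃ Greatest
  greatest {b} bounded {k} pk with greatest-below (suc b)
  ... | inj₁ (m , pm , max) = m , pm , λ k pk → max k (s≤s (bounded pk)) pk
  ... | inj₂ none           = ⊥-elim (none k (s≤s (bounded pk)) pk)

module StrictTotalOn {n : ℕ} {R : Rel (Fin n) 0ℓ} (R? : Decidable R) {S : Fin n → Set} (S? : ∀ x → Dec (S x))
         (total : ∀ {x y} → S x → S y → x ≢ y → R x y ⊎ R y x)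
         (asym : ∀ {x y} → R x y → ¬ R y x)
         (transitive : ∀ {x y z} → S x → S z → R x y → R y z → R x z) where

  Maximum : Fin n → Set
  Maximum m = S m × (∀ y → S y → y ≢ m → R y m)

  NonMaximal : Fin n → Set
  NonMaximal x = S x × ∃[ y ] S y × R x y

  private
    MaximumIn : List (Fin n) → Fin n → Set
    MaximumIn L m = S m × (∀ y → y ∈L L → S y → y ≢ m → R y m)

    maximumIn : ∀ L → (∀ x → x ∈L L → ¬ S x) ⊎ ∃ (MaximumIn L)
    maximumIn [] = inj₁ (λ _ ())
    maximumIn (x ∷ L) with S? x | maximumIn L
    ... | no ¬sx | inj₁ none = inj₁ λ { y (here refl) → ¬sx ; y (there y∈L) → none y y∈L }
    ... | no ¬sx | inj₂ (m , sm , max) =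
      inj₂ (m , sm , λ { y (here refl) sy → ⊥-elim (¬sx sy) ; y (there y∈L) → max y y∈L })
    ... | yes sx | inj₁ none =
      inj₂ (x , sx , λ { y (here refl) _ y≢x → ⊥-elim (y≢x refl)
                       ; y (there y∈L) sy → ⊥-elim (none y y∈L sy) })
    ... | yes sx | inj₂ (m , sm , max) with x ≟ m
    ...   | yes refl = inj₂ (m , sm , λ { y (here refl) _ y≢m → ⊥-elim (y≢m refl)
                                         ; y (there y∈L) → max y y∈L })
    ...   | no x≢m with total sx sm x≢m
    ...     | inj₁ xRm = inj₂ (m , sm , λ { y (here refl) _ _ → xRm ; y (there y∈L) → max y y∈L })
    ...     | inj₂ mRx = inj₂ (x , sx , below-x)
      where
      below-x : ∀ y → y ∈L x ∷ L → S y → y ≢ x → R y x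
      below-x y (here refl)  _  y≢x = ⊥-elim (y≢x refl)
      below-x y (there y∈L) sy _   with y ≟ m
      ... | yes refl = mRx
      ... | no y≢m   = transitive sy sx (max y y∈L sy y≢m) mRx

  maximum : (∀ x → ¬ S x) ⊎ ∃ Maximum
  maximum with maximumIn (allFin n)
  ... | inj₁ none          = inj₁ (λ x → none x (∈-allFin x))
  ... | inj₂ (m , sm , max) = inj₂ (m , sm , λ y → max y (∈-allFin y))

  nonMaximal? : ∀ x → Dec (NonMaximal x)
  nonMaximal? x = S? x ×-dec Finₚ.any? (λ y → S? y ×-dec R? x y)

  count-nonMaximal : sum (λ x → indicator (nonMaximal? x)) ≡ sum (λ x → indicator (S? x)) ∸ 1
  count-nonMaximal with maximum
  ... | inj₁ none = trans (sum-zero _ (λ x → indicator-no (nonMaximal? x) (none x ∘ proj₁)))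
                          (sym (cong (_∸ 1) (sum-zero _ (λ x → indicator-no (S? x) (none x)))))
  ... | inj₂ (m , sm , max) = sym (begin
    sum (λ x → indicator (S? x)) ∸ 1
      ≡⟨ cong (_∸ 1) (sum-cong-≗ (λ x → split x (x ≟ m))) ⟩
    sum (λ x → indicator (nonMaximal? x) + indicator (x ≟ m)) ∸ 1
      ≡⟨ cong (_∸ 1) (∑-distrib-+ (λ x → indicator (nonMaximal? x)) _) ⟩
    sum (λ x → indicator (nonMaximal? x)) + sum (λ x → indicator (x ≟ m)) ∸ 1
      ≡⟨ cong (λ k → sum (λ x → indicator (nonMaximal? x)) + k ∸ 1) (count-≡ m) ⟩
    sum (λ x → indicator (nonMaximal? x)) + 1 ∸ 1
      ≡⟨ ℕₚ.m+n∸n≡m _ 1 ⟩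
    sum (λ x → indicator (nonMaximal? x)) ∎)
    where
    open ≡-Reasoning
    maximum-maximal : ¬ NonMaximal m
    maximum-maximal (_ , y , sy , mRy) with y ≟ m
    ... | yes refl = asym mRy mRy
    ... | no y≢m   = asym mRy (max y sy y≢m)
    split : ∀ x → Dec (x ≡ m) → indicator (S? x) ≡ indicator (nonMaximal? x) + indicator (x ≟ m)
    split x (yes refl) = trans (indicator-yes (S? x) sm)
      (sym (cong₂ _+_ (indicator-no (nonMaximal? x) maximum-maximal) (indicator-yes (x ≟ x) refl)))
    split x (no x≢m) = trans (indicator-cong (S? x) (nonMaximal? x) (λ sx → sx , m , sm , max x sx x≢m) proj₁)
                             (sym (trans (cong (indicator (nonMaximal? x) +_) (indicator-no (x ≟ m) x≢m))
                                         (ℕₚ.+-identityʳ _)))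

-- Closures, and decidability of the transitive closure on Fin n

map⁺ : ∀ {A : Set} {R S : Rel A 0ℓ} → (∀ {a b} → R a b → S a b) →
       ∀ {a b} → TransClosure R a b → TransClosure S a b
map⁺ f [ r ]    = [ f r ]
map⁺ f (r ∷ rs) = f r ∷ map⁺ f rs

◅⇒⁺ : ∀ {A : Set} {R : Rel A 0ℓ} {a b c} → R a b → Star R b c → TransClosure R a c
◅⇒⁺ r ε        = [ r ]
◅⇒⁺ r (s ◅ ss) = r ∷ ◅⇒⁺ s ss

⁺⇒⋆ : ∀ {A : Set} {R : Rel A 0ℓ} {a b} → TransClosure R a b → Star R a b
⁺⇒⋆ [ r ]    = r ◅ ε
⁺⇒⋆ (r ∷ rs) = r ◅ ⁺⇒⋆ rs

⋆-⁺ : ∀ {A : Set} {R : Rel A 0ℓ} {a b c} → Star R a b → TransClosure R b c → TransClosure R a c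
⋆-⁺ ε        rs = rs
⋆-⁺ (r ◅ rs) ss = r ∷ ⋆-⁺ rs ss

module _ {n : ℕ} {R : Rel (Fin n) 0ℓ} where

  infixr 5 _∷⟨_⟩_

  data InnerBelow (k : ℕ) : Rel (Fin n) 0ℓ where
    [_]     : ∀ {a b} → R a b → InnerBelow k a b
    _∷⟨_⟩_ : ∀ {a c b} → R a c → toℕ c < k → InnerBelow k c b → InnerBelow k a b

  InnerBelow⇒⁺ : ∀ {k a b} → InnerBelow k a b → TransClosure R a b
  InnerBelow⇒⁺ [ r ]           = [ r ]
  InnerBelow⇒⁺ (r ∷⟨ _ ⟩ rs) = r ∷ InnerBelow⇒⁺ rs

  ⁺⇒InnerBelow : ∀ {a b} → TransClosure R a b → InnerBelow n a b
  ⁺⇒InnerBelow [ r ]                = [ r ]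
  ⁺⇒InnerBelow (_∷_ {y = c} r rs) = r ∷⟨ Finₚ.toℕ<n c ⟩ ⁺⇒InnerBelow rs

  InnerBelow-mono : ∀ {k l a b} → k ≤ l → InnerBelow k a b → InnerBelow l a b
  InnerBelow-mono k≤l [ r ]            = [ r ]
  InnerBelow-mono k≤l (r ∷⟨ c<k ⟩ rs) = r ∷⟨ ℕₚ.<-≤-trans c<k k≤l ⟩ InnerBelow-mono k≤l rs

  InnerBelow-join : ∀ {k a c b} → InnerBelow k a c → toℕ c < k → InnerBelow k c b → InnerBelow k a b
  InnerBelow-join [ r ]              c<k ss = r ∷⟨ c<k ⟩ ss
  InnerBelow-join (r ∷⟨ d<k ⟩ rs) c<k ss = r ∷⟨ d<k ⟩ InnerBelow-join rs c<k ss

  InnerBelow-split : ∀ {k a b} (w : Fin n) → toℕ w ≡ k → InnerBelow (suc k) a b →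
                     InnerBelow k a b ⊎ (InnerBelow k a w × InnerBelow k w b)
  InnerBelow-split w w≡k [ r ] = inj₁ [ r ]
  InnerBelow-split w w≡k (_∷⟨_⟩_ {c = c} r c<1+k rs)
    with InnerBelow-split w w≡k rs | ℕₚ.m≤n⇒m<n∨m≡n (ℕₚ.≤-pred c<1+k)
  ... | inj₁ ss         | inj₁ c<k = inj₁ (r ∷⟨ c<k ⟩ ss)
  ... | inj₂ (ss , ts) | inj₁ c<k = inj₂ (r ∷⟨ c<k ⟩ ss , ts)
  ... | inj₁ ss         | inj₂ c≡k rewrite Finₚ.toℕ-injective (trans c≡k (sym w≡k)) = inj₂ ([ r ] , ss)
  ... | inj₂ (_ , ts)   | inj₂ c≡k rewrite Finₚ.toℕ-injective (trans c≡k (sym w≡k)) = inj₂ ([ r ] , ts)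

  module _ (R? : Decidable R) where

    -- Floyd–Warshall: a path with inner vertices below k + 1 either avoids the vertex k
    -- or splits at it into two paths with inner vertices below k.
    innerBelow? : ∀ k → k ≤ n → Decidable (InnerBelow k)
    innerBelow? zero    _   a b = map′ [_] (λ { [ r ] → r ; (_ ∷⟨ () ⟩ _) }) (R? a b)
    innerBelow? (suc k) k<n a b =
      map′ (λ { (inj₁ rs) → InnerBelow-mono (ℕₚ.n≤1+n k) rs
              ; (inj₂ (rs , ss)) → InnerBelow-join (InnerBelow-mono (ℕₚ.n≤1+n k) rs) w<1+k
                                                    (InnerBelow-mono (ℕₚ.n≤1+n k) ss) })
           (InnerBelow-split w w≡k)
           (innerBelow? k k≤n a b ⊎-dec (innerBelow? k k≤n a w ×-dec innerBelow? k k≤n w b))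
      where
      w : Fin n
      w = Fin.fromℕ< k<n
      w≡k : toℕ w ≡ k
      w≡k = Finₚ.toℕ-fromℕ< k<n
      w<1+k : toℕ w < suc k
      w<1+k = subst (_< suc k) (sym w≡k) ℕₚ.≤-refl
      k≤n : k ≤ n
      k≤n = ℕₚ.<⇒≤ k<n

    transClosure? : Decidable (TransClosure R)
    transClosure? a b = map′ InnerBelow⇒⁺ ⁺⇒InnerBelow (innerBelow? n ℕₚ.≤-refl a b)

module _ {n : ℕ} {G : Graph n} where

  Reach : Orientation G → Rel (Fin n) 0ℓ
  Reach D = TransClosure (Arc D)

  Path⇒Reach : ∀ {D : Orientation G} {a b} → Path D a b → Reach D a b
  Path⇒Reach (step r) = [ r ]
  Path⇒Reach (r ∷ rs) = r ∷ Path⇒Reach rs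

  Reach⇒Path : ∀ {D : Orientation G} {a b} → Reach D a b → Path D a b
  Reach⇒Path [ r ]    = step r
  Reach⇒Path (r ∷ rs) = r ∷ Reach⇒Path rs

  edge-irrefl : ∀ {a} → ¬ Edge G a a
  edge-irrefl {a} e with trans (sym e) (irrefl G a)
  ... | ()

  module _ (D : Orientation G) where

    arc? : Decidable (Arc D)
    arc? a b = (adj G a b Boolₚ.≟ true) ×-dec (dir D a b Boolₚ.≟ true)

    acyclic? : Dec (Acyclic D)
    acyclic? = map′ (λ noLoop u → noLoop u ∘ Path⇒Reach) (λ acyc u → acyc u ∘ Reach⇒Path)
                    (Finₚ.all? (λ u → ¬? (transClosure? arc? u u)))

    arc⇒≢ : ∀ {a b} → Arc D a b → a ≢ b
    arc⇒≢ (e , _) refl = edge-irrefl e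

    arc-asym : ∀ {a b} → Arc D a b → ¬ Arc D b a
    arc-asym {a} {b} (_ , ab) (e , ba) with trans (sym ba) (dirEdge D b a e)
    ... | ba≡¬ab rewrite ab with ba≡¬ab
    ... | ()

    edge⇒arc : ∀ {a b} → Edge G a b → Arc D a b ⊎ Arc D b a
    edge⇒arc {a} {b} e with dir D a b in ab
    ... | true  = inj₁ (e , refl)
    ... | false = inj₂ (trans (Graph.sym G b a) e , trans (dirEdge D b a (trans (Graph.sym G b a) e))
                                                         (cong not ab))

  record SameDir (D₁ D₂ : Orientation G) : Set where
    constructor sameDir
    field same : ∀ x y → dir D₁ x y ≡ dir D₂ x y

  sameDir-sym : ∀ {D₁ D₂ : Orientation G} → SameDir D₁ D₂ → SameDir D₂ D₁
  sameDir-sym (sameDir same) = sameDir λ x y → sym (same x y)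

  module _ {D₁ D₂ : Orientation G} (D₁≈D₂ : SameDir D₁ D₂) where
    open SameDir D₁≈D₂

    arc-sameDir : ∀ {a b} → Arc D₁ a b → Arc D₂ a b
    arc-sameDir {a} {b} (e , d) = e , trans (sym (same a b)) d

    acyclic-sameDir : Acyclic D₂ → Acyclic D₁
    acyclic-sameDir acyc u = acyc u ∘ Reach⇒Path ∘ map⁺ arc-sameDir ∘ Path⇒Reach

    reverse-sameDir : ∀ u w → SameDir (reverse D₁ u w) (reverse D₂ u w)
    reverse-sameDir u w = sameDir λ x y → helper x y
      where
      helper : ∀ x y → dir (reverse D₁ u w) x y ≡ dir (reverse D₂ u w) x y
      helper x y rewrite same x y = refl

  dependent-sameDir : ∀ {D₁ D₂ : Orientation G} → SameDir D₁ D₂ →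
                      ∀ {p} → Dependent D₁ p → Dependent D₂ p
  dependent-sameDir D₁≈D₂ {u , w} (r , cyclic) =
    arc-sameDir D₁≈D₂ r , cyclic ∘ acyclic-sameDir (reverse-sameDir D₁≈D₂ u w)

  numDep-sameDir : ∀ {D₁ D₂ : Orientation G} → SameDir D₁ D₂ → ∀ {k} → NumDep D₁ k → NumDep D₂ k
  numDep-sameDir D₁≈D₂ (L , unique , dep , complete , len) =
    L , unique , All.map (dependent-sameDir D₁≈D₂) dep ,
    (λ p → complete p ∘ dependent-sameDir (sameDir-sym D₁≈D₂)) , len

  -- Reversing an arc; dependent arcs are the arcs with a detour

  module _ (D : Orientation G) (u w : Fin n) where

    reverse-uw : dir (reverse D u w) u w ≡ false
    reverse-uw with u ≟ u | w ≟ w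
    ... | yes _ | yes _ = refl
    ... | no u≢u | _     = ⊥-elim (u≢u refl)
    ... | yes _ | no w≢w = ⊥-elim (w≢w refl)

    reverse-wu : u ≢ w → dir (reverse D u w) w u ≡ true
    reverse-wu u≢w with w ≟ u | u ≟ w | w ≟ w | u ≟ u
    ... | yes w≡u | _        | _      | _      = ⊥-elim (u≢w (sym w≡u))
    ... | no _    | yes u≡w | _      | _      = ⊥-elim (u≢w u≡w)
    ... | no _    | no _     | yes _ | yes _ = refl
    ... | no _    | no _     | no w≢w | _      = ⊥-elim (w≢w refl)
    ... | no _    | no _     | yes _ | no u≢u = ⊥-elim (u≢u refl)

    reverse-other : ∀ x y → (x , y) ≢ (u , w) → (x , y) ≢ (w , u) → dir (reverse D u w) x y ≡ dir D x y
    reverse-other x y ≢uw ≢wu with x ≟ u | y ≟ w | x ≟ w | y ≟ u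
    ... | yes refl | yes refl | _        | _        = ⊥-elim (≢uw refl)
    ... | yes _    | no _     | yes refl | yes refl = ⊥-elim (≢wu refl)
    ... | yes _    | no _     | yes _    | no _     = refl
    ... | yes _    | no _     | no _     | _        = refl
    ... | no _     | _        | yes refl | yes refl = ⊥-elim (≢wu refl)
    ... | no _     | _        | yes _    | no _     = refl
    ... | no _     | _        | no _     | _        = refl

  dependent? : (D : Orientation G) → ∀ p → Dec (Dependent D p)
  dependent? D (u , w) = arc? D u w ×-dec ¬? (acyclic? (reverse D u w))

  Detour : Orientation G → Fin n → Fin n → Set
  Detour D u w = ∃[ x ] Arc D u x × x ≢ w × Reach D x w

  module _ {D : Orientation G} (acyc : Acyclic D) where

    no-loop : ∀ {a} → ¬ Reach D a a
    no-loop = acyc _ ∘ Reach⇒Path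

    module _ {u w : Fin n} (uw : Arc D u w) where
      private
        D′ : Orientation G
        D′ = reverse D u w
        u≢w : u ≢ w
        u≢w = arc⇒≢ D uw

      arc-reverse : ∀ {a b} → (a , b) ≢ (u , w) → Arc D a b → Arc D′ a b
      arc-reverse ab≢uw ab@(e , d) =
        e , trans (reverse-other D u w _ _ ab≢uw (λ { refl → arc-asym D uw ab })) d

      reach-reverse : ∀ {a b} → ¬ Star (Arc D) a u → Reach D a b → Reach D′ a b
      reach-reverse ¬a⋆u [ r ]    = [ arc-reverse (λ { refl → ¬a⋆u ε }) r ]
      reach-reverse ¬a⋆u (r ∷ rs) =
        arc-reverse (λ { refl → ¬a⋆u ε }) r ∷ reach-reverse (¬a⋆u ∘ (r ◅_)) rs

      -- The detour u → x ⇝ w survives the reversal, and closes a cycle with the new arc w → u.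
      detour⇒dependent : Detour D u w → Dependent D (u , w)
      detour⇒dependent (x , ux , x≢w , x⇝w) = uw , λ acyc′ → acyc′ w (Reach⇒Path cycle)
        where
        cycle : Reach D′ w w
        cycle = (trans (Graph.sym G w u) (proj₁ uw) , reverse-wu D u w u≢w)
              ∷ arc-reverse (λ { refl → x≢w refl }) ux
              ∷ reach-reverse (no-loop ∘ ◅⇒⁺ ux) x⇝w

      private
        OtherArc : Rel (Fin n) 0ℓ
        OtherArc a b = Arc D a b × (a , b) ≢ (u , w)

        classify : ∀ {a b} → Arc D′ a b → (a , b) ≡ (w , u) ⊎ OtherArc a b
        classify {a} {b} (e , d) with (a , b) ≟² (w , u)
        ... | yes ab≡wu = inj₁ ab≡wu
        ... | no ab≢wu  = inj₂ ((e , trans (sym (reverse-other D u w a b ab≢uw ab≢wu)) d) , ab≢uw)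
          where
          ab≢uw : (a , b) ≢ (u , w)
          ab≢uw refl with trans (sym d) (reverse-uw D u w)
          ... | ()

        decompose : ∀ {a b} → Reach D′ a b →
                    TransClosure OtherArc a b ⊎ (Star OtherArc a w × Star OtherArc u b)
        decompose [ r ] with classify r
        ... | inj₁ refl = inj₂ (ε , ε)
        ... | inj₂ o    = inj₁ [ o ]
        decompose (r ∷ rs) with classify r | decompose rs
        ... | inj₁ refl | inj₁ os         = inj₂ (ε , ⁺⇒⋆ os)
        ... | inj₁ refl | inj₂ (_ , u⋆b) = inj₂ (ε , u⋆b)
        ... | inj₂ o    | inj₁ os         = inj₁ (o ∷ os)
        ... | inj₂ o    | inj₂ (x⋆w , u⋆b) = inj₂ (o ◅ x⋆w , u⋆b)

        other-detour : Star OtherArc u w → Detour D u w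
        other-detour ε                           = ⊥-elim (u≢w refl)
        other-detour ((ux , ux≢uw) ◅ ε)          = ⊥-elim (ux≢uw refl)
        other-detour ((ux , ux≢uw) ◅ o ◅ os) =
          _ , ux , (λ { refl → ux≢uw refl }) , map⁺ proj₁ (◅⇒⁺ o os)

      cyclic-reverse⇒detour : ¬ Acyclic D′ → Detour D u w
      cyclic-reverse⇒detour cyclic with Finₚ.any? (λ z → transClosure? (arc? D′) z z)
      ... | no noCycle = ⊥-elim (cyclic (λ z → noCycle ∘ (z ,_) ∘ Path⇒Reach))
      ... | yes (z , cycle) with decompose cycle
      ...   | inj₁ os          = ⊥-elim (no-loop (map⁺ proj₁ os))
      ...   | inj₂ (z⋆w , u⋆z) = other-detour (u⋆z ◅◅ z⋆w)

    arc-reach⇒detour : ∀ {u x w} → Arc D u x → Reach D x w → Detour D u w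
    arc-reach⇒detour ux x⇝w = _ , ux , (λ { refl → no-loop x⇝w }) , x⇝w

    dependent⇒detour : ∀ {u w} → Dependent D (u , w) → Detour D u w
    dependent⇒detour (uw , cyclic) = cyclic-reverse⇒detour uw cyclic

  depCount : Orientation G → ℕ
  depCount D = sum² (λ p → indicator (dependent? D p))

  numDep⇒≡depCount : ∀ {D : Orientation G} {k} → NumDep D k → k ≡ depCount D
  numDep⇒≡depCount {D} (L , unique , dep , complete , refl) =
    trans (length-unique L unique)
          (sum²-cong (λ p → indicator-cong (p ∈? L) (dependent? D p) (All.lookup dep) (complete p)))

  numDep-depCount : ∀ (D : Orientation G) → NumDep D (depCount D)
  numDep-depCount D = L , unique , dep , complete , numDep⇒≡depCount (L , unique , dep , complete , refl)
    where
    pairs : List (Pair n)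
    pairs = cartesianProduct (allFin n) (allFin n)
    L : List (Pair n)
    L = filter (dependent? D) pairs
    dep : All (Dependent D) L
    dep = All.tabulate (proj₂ ∘ ∈-filter⁻ (dependent? D) {xs = pairs})
    unique : Unique L
    unique = Uniqueₚ.filter⁺ (dependent? D)
               (Uniqueₚ.cartesianProduct⁺ (Uniqueₚ.allFin⁺ n) (Uniqueₚ.allFin⁺ n))
    complete : ∀ p → Dependent D p → p ∈L L
    complete (a , b) = ∈-filter⁺ (dependent? D) (∈-cartesianProduct⁺ (∈-allFin a) (∈-allFin b))

  depCount≤ : ∀ (D : Orientation G) → depCount D ≤ sum² {n} (λ _ → 1)
  depCount≤ D = sum²-mono-≤ (λ p → indicator≤1 (dependent? D p))

  numDep? : ∀ (D : Orientation G) k → Dec (NumDep D k)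
  numDep? D k = map′ (λ k≡d → subst (NumDep D) (sym k≡d) (numDep-depCount D)) numDep⇒≡depCount
                     (k ℕ.≟ depCount D)

  -- Deciding which values of d are attained, by searching all direction tables

  private
    Table : Set
    Table = Subset (n ℕ.* n)

    entry : Table → Fin n → Fin n → Bool
    entry T x y = Vec.lookup T (Fin.combine x y)

    ValidTable : Table → Set
    ValidTable T = ∀ x y → Edge G x y → entry T x y ≡ not (entry T y x)

    validTable? : ∀ T → Dec (ValidTable T)
    validTable? T = Finₚ.all? λ x → Finₚ.all? λ y →
                      (adj G x y Boolₚ.≟ true) →-dec (entry T x y Boolₚ.≟ not (entry T y x))

    orientation : ∀ T → ValidTable T → Orientation G
    orientation T valid = record { dir = entry T ; dirEdge = valid }

    table : Orientation G → Table
    table D = Vec.tabulate (λ i → uncurry (dir D) (Fin.remQuot n i))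

    entry-table : ∀ D x y → entry (table D) x y ≡ dir D x y
    entry-table D x y = trans (Vecₚ.lookup∘tabulate _ (Fin.combine x y))
                              (cong (uncurry (dir D)) (Finₚ.remQuot-combine x y))

    table-valid : ∀ D → ValidTable (table D)
    table-valid D x y e = trans (entry-table D x y)
                                (trans (dirEdge D x y e) (cong not (sym (entry-table D y x))))

    Good : ℕ → Orientation G → Set
    Good k D = Acyclic D × NumDep D k

    good-sameDir : ∀ {k} {D₁ D₂ : Orientation G} → SameDir D₁ D₂ → Good k D₁ → Good k D₂
    good-sameDir D₁≈D₂ (acyc , numDep) =
      acyclic-sameDir (sameDir-sym D₁≈D₂) acyc , numDep-sameDir D₁≈D₂ numDep

    GoodTable : ℕ → Table → Set
    GoodTable k T = Σ (ValidTable T) λ valid → Good k (orientation T valid)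

    goodTable? : ∀ k T → Dec (GoodTable k T)
    goodTable? k T with validTable? T
    ... | no invalid = no (invalid ∘ proj₁)
    ... | yes valid  = map′ (valid ,_) (λ (_ , good) → good-sameDir (sameDir λ _ _ → refl) good)
                            (acyclic? D ×-dec numDep? D k)
      where D = orientation T valid

  achieves? : ∀ k → Dec (Achieves G k)
  achieves? k = map′ (λ (T , valid , good) → orientation T valid , good)
                     (λ (D , good) → table D , table-valid D ,
                                     good-sameDir (sameDir λ x y → sym (entry-table D x y)) good)
                     (anySubset? (goodTable? k))

  does⇒ : ∀ {p} {P : Set p} (P? : Dec P) → does P? ≡ true → P
  does⇒ (yes p) _ = p

  ascending : Orientation G
  ascending = record { dir = λ x y → does (x Fin.<? y) ; dirEdge = ascending-dirEdge }
    where
    ascending-dirEdge : ∀ x y → Edge G x y → does (x Fin.<? y) ≡ not (does (y Fin.<? x))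
    ascending-dirEdge x y e with Finₚ.<-cmp x y
    ... | tri< x<y _ y≮x = trans (dec-true (x Fin.<? y) x<y) (cong not (sym (dec-false (y Fin.<? x) y≮x)))
    ... | tri≈ _ refl _  = ⊥-elim (edge-irrefl e)
    ... | tri> x≮y _ y<x = trans (dec-false (x Fin.<? y) x≮y) (cong not (sym (dec-true (y Fin.<? x) y<x)))

  ascending-acyclic : Acyclic ascending
  ascending-acyclic u = Finₚ.<-irrefl refl ∘ increasing ∘ Path⇒Reach
    where
    arc⇒< : ∀ {a b} → Arc ascending a b → a Fin.< b
    arc⇒< {a} {b} (_ , d) = does⇒ (a Fin.<? b) d
    increasing : ∀ {a b} → Reach ascending a b → a Fin.< b
    increasing [ r ]    = arc⇒< r
    increasing (r ∷ rs) = ℕₚ.<-trans (arc⇒< r) (increasing rs)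

  dmin-exists : ∃ (IsDmin G)
  dmin-exists = least achieves? (ascending , ascending-acyclic , numDep-depCount ascending)

  dmax-exists : ∃ (IsDmax G)
  dmax-exists = greatest achieves? bounded (ascending , ascending-acyclic , numDep-depCount ascending)
    where
    bounded : ∀ {k} → Achieves G k → k ≤ sum² {n} (λ _ → 1)
    bounded (D , _ , numDep) = subst (_≤ _) (sym (numDep⇒≡depCount numDep)) (depCount≤ D)

-- Adding a vertex joined to a clique

module Extension {n : ℕ} (G : Graph n) (Q : Subset n) (clique : IsClique G Q) where

  -- d(D′) splits as (outDeg ∸ 1) + ((inDeg ∸ 1) + oldDep), and the degrees sum to q;
  -- oldDep counts the dependent arcs of D′ inside G.
  private
    one-sided-count : ∀ a b z → 1 ≤ a + b → a ≡ 0 ⊎ b ≡ 0 → 1 + ((b ∸ 1) + ((a ∸ 1) + z)) ≡ z + (a + b)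
    one-sided-count zero    (suc b) z _ _ = rearrange b z
      where
      rearrange : ∀ b z → 1 + (b + (0 + z)) ≡ z + (0 + suc b)
      rearrange = solve-∀
    one-sided-count (suc a) zero    z _ _ = rearrange a z
      where
      rearrange : ∀ a z → 1 + (0 + (a + z)) ≡ z + (suc a + 0)
      rearrange = solve-∀
    one-sided-count zero    zero    z () _
    one-sided-count (suc a) (suc b) z _ (inj₁ ())
    one-sided-count (suc a) (suc b) z _ (inj₂ ())

    two-sided-count-bounds : ∀ a b z c → 1 ≤ a → 1 ≤ b → c ≤ z → z ≤ c + 1 →
                             c + (a + b) ≤ 2 + ((b ∸ 1) + ((a ∸ 1) + z)) ×
                             1 + ((b ∸ 1) + ((a ∸ 1) + z)) ≤ c + (a + b)
    two-sided-count-bounds (suc a) (suc b) z c _ _ c≤z z≤c+1 =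
      (begin
        c + (suc a + suc b)  ≤⟨ ℕₚ.+-monoˡ-≤ (suc a + suc b) c≤z ⟩
        z + (suc a + suc b)  ≡⟨ rearrange₁ a b z ⟩
        2 + (b + (a + z))    ∎) ,
      (begin
        1 + (b + (a + z))    ≡⟨ rearrange₂ a b z ⟩
        z + suc (a + b)      ≤⟨ ℕₚ.+-monoˡ-≤ (suc (a + b)) z≤c+1 ⟩
        c + 1 + suc (a + b)  ≡⟨ rearrange₃ a b c ⟩
        c + (suc a + suc b)  ∎)
      where
      open ℕₚ.≤-Reasoning
      rearrange₁ : ∀ a b z → z + (suc a + suc b) ≡ 2 + (b + (a + z))
      rearrange₁ = solve-∀
      rearrange₂ : ∀ a b z → 1 + (b + (a + z)) ≡ z + suc (a + b)
      rearrange₂ = solve-∀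
      rearrange₃ : ∀ a b c → c + 1 + suc (a + b) ≡ c + (suc a + suc b)
      rearrange₃ = solve-∀

    exact⇒bounds : ∀ c d′ k → 1 + d′ ≡ c + k → c + k ≤ 2 + d′ × 1 + d′ ≤ c + k
    exact⇒bounds c d′ k 1+d′≡c+k =
      ℕₚ.≤-trans (ℕₚ.≤-reflexive (sym 1+d′≡c+k)) (ℕₚ.n≤1+n _) , ℕₚ.≤-reflexive 1+d′≡c+k

  G′ : Graph (suc n)
  G′ = addVertex G Q

  InQ : Fin n → Set
  InQ x = Vec.lookup Q x ≡ true

  edge-Q : ∀ {x y} → InQ x → InQ y → x ≢ y → Edge G x y
  edge-Q {x} {y} x∈Q y∈Q = clique x y (Vecₚ.lookup⇒[]= x Q x∈Q) (Vecₚ.lookup⇒[]= y Q y∈Q)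

  q : ℕ
  q = sum (λ x → indicator (Vec.lookup Q x Boolₚ.≟ true))

  restrict : Orientation G′ → Orientation G
  restrict D′ = record { dir = λ x y → dir D′ (suc x) (suc y) ; dirEdge = λ x y → dirEdge D′ (suc x) (suc y) }

  module _ (D′ : Orientation G′) where

    reach-restrict : ∀ {x y} → Reach (restrict D′) x y → Reach D′ (suc x) (suc y)
    reach-restrict [ r ]    = [ r ]
    reach-restrict (r ∷ rs) = r ∷ reach-restrict rs

    restrict-acyclic : Acyclic D′ → Acyclic (restrict D′)
    restrict-acyclic acyc′ x = acyc′ (suc x) ∘ Reach⇒Path ∘ reach-restrict ∘ Path⇒Reach

  extend : Orientation G → Orientation G′
  extend D = record { dir = dir′ ; dirEdge = dirEdge′ }
    where
    dir′ : Fin (suc n) → Fin (suc n) → Bool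
    dir′ zero    _       = true
    dir′ (suc x) zero    = false
    dir′ (suc x) (suc y) = dir D x y
    dirEdge′ : ∀ x y → Edge G′ x y → dir′ x y ≡ not (dir′ y x)
    dirEdge′ zero    zero    ()
    dirEdge′ zero    (suc y) _ = refl
    dirEdge′ (suc x) zero    _ = refl
    dirEdge′ (suc x) (suc y) e = dirEdge D x y e

  restrict-extend : ∀ D → SameDir (restrict (extend D)) D
  restrict-extend D = sameDir λ _ _ → refl

  extend-acyclic : ∀ {D} → Acyclic D → Acyclic (extend D)
  extend-acyclic {D} acyc zero    = no-return ∘ Path⇒Reach
    where
    no-arc-into-new : ∀ {a} → ¬ Reach (extend D) a zero
    no-arc-into-new {zero}  [ (() , _) ]
    no-arc-into-new {suc _} [ (_ , ()) ]
    no-arc-into-new (_ ∷ rs) = no-arc-into-new rs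
    no-return : ¬ Reach (extend D) zero zero
    no-return [ (() , _) ]
    no-return (_ ∷ rs) = no-arc-into-new rs
  extend-acyclic {D} acyc (suc x) = no-loop acyc ∘ reach-old ∘ Path⇒Reach
    where
    reach-old : ∀ {a b} → Reach (extend D) (suc a) (suc b) → Reach D a b
    reach-old [ r ]                       = [ r ]
    reach-old (_∷_ {y = zero} (_ , ()) _)
    reach-old (_∷_ {y = suc _} r rs)     = r ∷ reach-old rs

  module Analysis (D′ : Orientation G′) (acyc′ : Acyclic D′) where

    D : Orientation G
    D = restrict D′

    acyc : Acyclic D
    acyc = restrict-acyclic D′ acyc′

    In Out : Fin n → Set
    In x  = Arc D′ (suc x) zero
    Out x = Arc D′ zero (suc x)

    in? : ∀ x → Dec (In x)
    in? x = arc? D′ (suc x) zero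

    out? : ∀ x → Dec (Out x)
    out? x = arc? D′ zero (suc x)

    inDeg outDeg oldDep : ℕ
    inDeg  = sum (λ x → indicator (in? x))
    outDeg = sum (λ x → indicator (out? x))
    oldDep = sum² (λ (u , w) → indicator (dependent? D′ (suc u , suc w)))

    no-new-loop : ¬ Arc D′ zero zero
    no-new-loop (() , _)

    -- Q induces a tournament in D, and acyclicity makes it a transitive one.

    Q-total : ∀ {x y} → InQ x → InQ y → x ≢ y → Arc D x y ⊎ Arc D y x
    Q-total x∈Q y∈Q x≢y = edge⇒arc D (edge-Q x∈Q y∈Q x≢y)

    reach⇒arc-Q : ∀ {x y} → InQ x → InQ y → Reach D x y → Arc D x y
    reach⇒arc-Q {x} {y} x∈Q y∈Q x⇝y with x ≟ y
    ... | yes refl = ⊥-elim (no-loop acyc x⇝y)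
    ... | no x≢y with Q-total x∈Q y∈Q x≢y
    ...   | inj₁ xy = xy
    ...   | inj₂ yx = ⊥-elim (no-loop acyc (yx ∷ x⇝y))

    Q-transitive : ∀ {x y z} → InQ x → InQ z → Arc D x y → Arc D y z → Arc D x z
    Q-transitive x∈Q z∈Q xy yz = reach⇒arc-Q x∈Q z∈Q (xy ∷ [ yz ])

    Through : Fin n → Fin n → Set
    Through x y = (∃[ a ] Star (Arc D) x a × In a) × (∃[ b ] Out b × Star (Arc D) b y)

    into-new : ∀ {x} → Reach D′ (suc x) zero → ∃[ a ] Star (Arc D) x a × In a
    into-new [ r ]                   = _ , ε , r
    into-new (_∷_ {y = zero}  r _)   = _ , ε , r
    into-new (_∷_ {y = suc _} r rs) with into-new rs
    ... | a , x⋆a , ia = a , r ◅ x⋆a , ia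

    via-new : ∀ {x a} → Star (Arc D) x a → In a → Reach D′ (suc x) zero
    via-new ε        ia = [ ia ]
    via-new (r ◅ rs) ia = r ∷ via-new rs ia

    out-of-new : ∀ {y} → Reach D′ zero (suc y) → ∃[ b ] Out b × Star (Arc D) b y
    old-or-through : ∀ {x y} → Reach D′ (suc x) (suc y) → Reach D x y ⊎ Through x y

    out-of-new [ r ]                  = _ , r , ε
    out-of-new (_∷_ {y = zero} r _)  = ⊥-elim (no-new-loop r)
    out-of-new (_∷_ {y = suc _} r rs) with old-or-through rs
    ... | inj₁ b⇝y         = _ , r , ⁺⇒⋆ b⇝y
    ... | inj₂ (_ , after) = after

    old-or-through [ r ]                   = inj₁ [ r ]
    old-or-through (_∷_ {y = zero} r rs)   = inj₂ ((_ , ε , r) , out-of-new rs)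
    old-or-through (_∷_ {y = suc _} r rs) with old-or-through rs
    ... | inj₁ c⇝y                  = inj₁ (r ∷ c⇝y)
    ... | inj₂ ((a , c⋆a , ia) , after) = inj₂ ((a , r ◅ c⋆a , ia) , after)

    module InOrder  = StrictTotalOn (arc? D) in?
      (λ ix iy → Q-total (proj₁ ix) (proj₁ iy)) (arc-asym D) (λ ix iz → Q-transitive (proj₁ ix) (proj₁ iz))
    module OutOrder = StrictTotalOn (λ x y → arc? D y x) out?
      (λ ox oy x≢y → Data.Sum.swap (Q-total (proj₁ ox) (proj₁ oy) x≢y)) (λ yx xy → arc-asym D xy yx)
      (λ ox oz yx zy → Q-transitive (proj₁ oz) (proj₁ ox) zy yx)

    dependent-in⇒ : ∀ {u} → Dependent D′ (suc u , zero) → InOrder.NonMaximal u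
    dependent-in⇒ dep with dependent⇒detour acyc′ dep
    ... | zero  , _  , x≢new , _   = ⊥-elim (x≢new refl)
    ... | suc c , uc , _     , c⇝v with into-new c⇝v
    ...   | a , c⋆a , ia = proj₁ dep , a , ia , reach⇒arc-Q (proj₁ (proj₁ dep)) (proj₁ ia) (◅⇒⁺ uc c⋆a)

    dependent-in⇐ : ∀ {u} → InOrder.NonMaximal u → Dependent D′ (suc u , zero)
    dependent-in⇐ (iu , a , ia , ua) = detour⇒dependent acyc′ iu (suc a , ua , (λ ()) , [ ia ])

    dependent-out⇒ : ∀ {w} → Dependent D′ (zero , suc w) → OutOrder.NonMaximal w
    dependent-out⇒ dep with dependent⇒detour acyc′ dep
    ... | zero  , vv , _ , _    = ⊥-elim (no-new-loop vv)
    ... | suc b , ob , _ , b⇝w with old-or-through b⇝w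
    ...   | inj₁ b⇝w′ = proj₁ dep , b , ob , reach⇒arc-Q (proj₁ ob) (proj₁ (proj₁ dep)) b⇝w′
    ...   | inj₂ ((a , b⋆a , ia) , _) = ⊥-elim (no-loop acyc′ (ob ∷ via-new b⋆a ia))

    dependent-out⇐ : ∀ {w} → OutOrder.NonMaximal w → Dependent D′ (zero , suc w)
    dependent-out⇐ (ow , b , ob , bw) =
      detour⇒dependent acyc′ ow (suc b , ob , arc⇒≢ D bw ∘ suc-injective , [ bw ])

    dependent-old : ∀ {u w} → Dependent D (u , w) → Dependent D′ (suc u , suc w)
    dependent-old dep with dependent⇒detour acyc dep
    ... | x , ux , x≢w , x⇝w =
      detour⇒dependent acyc′ (proj₁ dep) (suc x , ux , x≢w ∘ suc-injective , reach-restrict D′ x⇝w)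

    dependent-new : ∀ {u w} → Dependent D′ (suc u , suc w) → Dependent D (u , w) ⊎ (Arc D u w × Through u w)
    dependent-new dep with dependent⇒detour acyc′ dep
    ... | zero  , iu , _ , v⇝w = inj₂ (proj₁ dep , (_ , ε , iu) , out-of-new v⇝w)
    ... | suc x , ux , x≢w , x⇝w with old-or-through x⇝w
    ...   | inj₁ x⇝w′ = inj₁ (detour⇒dependent acyc (proj₁ dep) (x , ux , x≢w ∘ cong suc , x⇝w′))
    ...   | inj₂ ((a , x⋆a , ia) , after) = inj₂ (proj₁ dep , (a , ux ◅ x⋆a , ia) , after)

    -- Every path through the new vertex can be rerouted along the arc from the last
    -- in-neighbour to the first out-neighbour, so only that arc can become dependent.
    module _ {last first} (lastIn : InOrder.Maximum last) (firstOut : OutOrder.Maximum first) where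

      to-last : ∀ {a} → In a → Star (Arc D) a last
      to-last {a} ia with a ≟ last
      ... | yes refl   = ε
      ... | no a≢last = proj₂ lastIn a ia a≢last ◅ ε

      from-first : ∀ {b} → Out b → Star (Arc D) first b
      from-first {b} ob with b ≟ first
      ... | yes refl    = ε
      ... | no b≢first = proj₂ firstOut b ob b≢first ◅ ε

      last→first : Arc D last first
      last→first with last ≟ first
      ... | yes refl = ⊥-elim (arc-asym D′ (proj₁ lastIn) (proj₁ firstOut))
      ... | no l≢f with Q-total (proj₁ (proj₁ lastIn)) (proj₁ (proj₁ firstOut)) l≢f
      ...   | inj₁ lf = lf
      ...   | inj₂ fl = ⊥-elim (no-loop acyc′ (proj₁ firstOut ∷ fl ∷ [ proj₁ lastIn ]))

      through⇒dependent : ∀ {u w} → Arc D u w → Through u w → Dependent D (u , w) ⊎ (u , w) ≡ (last , first)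
      through⇒dependent {u} {w} uw ((a , u⋆a , ia) , (b , ob , b⋆w)) =
        reroute (u⋆a ◅◅ to-last ia) (from-first ob ◅◅ b⋆w)
        where
        via : ∀ {x} → Arc D u x → Reach D x w → Dependent D (u , w)
        via ux x⇝w = detour⇒dependent acyc uw (arc-reach⇒detour acyc ux x⇝w)
        reroute : Star (Arc D) u last → Star (Arc D) first w → Dependent D (u , w) ⊎ (u , w) ≡ (last , first)
        reroute ε        ε        = inj₂ refl
        reroute ε        (r ◅ rs) = inj₁ (via last→first (◅⇒⁺ r rs))
        reroute (r ◅ rs) f⋆w      = inj₁ (via r (⋆-⁺ rs (◅⇒⁺ last→first f⋆w)))

      oldDep≤1+depCount : oldDep ≤ depCount D + 1
      oldDep≤1+depCount = begin
        oldDep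
          ≤⟨ sum²-mono-≤ pointwise ⟩
        sum² (λ p → indicator (dependent? D p) + indicator (p ≟² (last , first)))
          ≡⟨ sum²-distrib-+ (λ p → indicator (dependent? D p)) _ ⟩
        depCount D + sum² (λ p → indicator (p ≟² (last , first)))
          ≡⟨ cong (depCount D +_) (count²-≡ (last , first)) ⟩
        depCount D + 1 ∎
        where
        open ℕₚ.≤-Reasoning
        pointwise : ∀ p → indicator (dependent? D′ (suc (proj₁ p) , suc (proj₂ p))) ≤
                          indicator (dependent? D p) + indicator (p ≟² (last , first))
        pointwise (u , w) with dependent? D′ (suc u , suc w)
        ... | no _ = z≤n
        ... | yes dep′ with dependent-new dep′
        ...   | inj₁ dep = ℕₚ.≤-trans (indicator≥1 (dependent? D (u , w)) dep) (ℕₚ.m≤m+n _ _)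
        ...   | inj₂ (uw , through) with through⇒dependent uw through
        ...     | inj₁ dep = ℕₚ.≤-trans (indicator≥1 (dependent? D (u , w)) dep) (ℕₚ.m≤m+n _ _)
        ...     | inj₂ eq  = ℕₚ.≤-trans (indicator≥1 ((u , w) ≟² (last , first)) eq) (ℕₚ.m≤n+m _ _)

    depCount-split : depCount D′ ≡ (outDeg ∸ 1) + ((inDeg ∸ 1) + oldDep)
    depCount-split = cong₂ _+_ (cong₂ _+_ no-loop-part out-part)
                               (trans (∑-distrib-+ (λ u → indicator (dependent? D′ (suc u , zero))) _)
                                      (cong (_+ oldDep) in-part))
      where
      no-loop-part : indicator (dependent? D′ (zero , zero)) ≡ 0
      no-loop-part = indicator-no (dependent? D′ (zero , zero)) (no-new-loop ∘ proj₁)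
      in-part : sum (λ u → indicator (dependent? D′ (suc u , zero))) ≡ inDeg ∸ 1
      in-part = trans (sum-cong-≗ (λ u → indicator-cong _ (InOrder.nonMaximal? u) dependent-in⇒ dependent-in⇐))
                      InOrder.count-nonMaximal
      out-part : sum (λ w → indicator (dependent? D′ (zero , suc w))) ≡ outDeg ∸ 1
      out-part = trans (sum-cong-≗ (λ w → indicator-cong _ (OutOrder.nonMaximal? w) dependent-out⇒ dependent-out⇐))
                       OutOrder.count-nonMaximal

    inDeg+outDeg≡q : inDeg + outDeg ≡ q
    inDeg+outDeg≡q = trans (sym (∑-distrib-+ (λ x → indicator (in? x)) _))
                           (sum-cong-≗ (λ x → in-or-out x (Vec.lookup Q x Boolₚ.≟ true)))
      where
      in-or-out : ∀ x (x∈Q? : Dec (InQ x)) → indicator (in? x) + indicator (out? x) ≡ indicator x∈Q?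
      in-or-out x (no x∉Q) =
        cong₂ _+_ (indicator-no (in? x) (x∉Q ∘ proj₁)) (indicator-no (out? x) (x∉Q ∘ proj₁))
      in-or-out x (yes x∈Q) with edge⇒arc D′ {suc x} {zero} x∈Q
      ... | inj₁ ix = cong₂ _+_ (indicator-yes (in? x) ix) (indicator-no (out? x) (arc-asym D′ ix))
      ... | inj₂ ox = cong₂ _+_ (indicator-no (in? x) (λ ix → arc-asym D′ ix ox)) (indicator-yes (out? x) ox)

    depCount≤oldDep : depCount D ≤ oldDep
    depCount≤oldDep = sum²-mono-≤ (λ p → indicator-mono (dependent? D p) _ dependent-old)

    oldDep≤depCount : (∀ x → ¬ In x) ⊎ (∀ x → ¬ Out x) → oldDep ≤ depCount D
    oldDep≤depCount one-sided = sum²-mono-≤ (λ p → indicator-mono _ (dependent? D p) (only-old ∘ dependent-new))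
      where
      only-old : ∀ {u w} → Dependent D (u , w) ⊎ (Arc D u w × Through u w) → Dependent D (u , w)
      only-old (inj₁ dep) = dep
      only-old (inj₂ (_ , (a , _ , ia) , (b , ob , _))) =
        ⊥-elim (Data.Sum.[ (λ no-in → no-in a ia) , (λ no-out → no-out b ob) ] one-sided)

    one-sided-degrees : (∀ x → ¬ In x) ⊎ (∀ x → ¬ Out x) → inDeg ≡ 0 ⊎ outDeg ≡ 0
    one-sided-degrees (inj₁ no-in)  = inj₁ (sum-zero _ (λ x → indicator-no (in? x) (no-in x)))
    one-sided-degrees (inj₂ no-out) = inj₂ (sum-zero _ (λ x → indicator-no (out? x) (no-out x)))

    depCount-one-sided : (∀ x → ¬ In x) ⊎ (∀ x → ¬ Out x) → 1 ≤ q → 1 + depCount D′ ≡ depCount D + q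
    depCount-one-sided one-sided 1≤q = begin
      1 + depCount D′                              ≡⟨ cong suc depCount-split ⟩
      1 + ((outDeg ∸ 1) + ((inDeg ∸ 1) + oldDep))  ≡⟨ one-sided-count inDeg outDeg oldDep 1≤in+out
                                                                        (one-sided-degrees one-sided) ⟩
      oldDep + (inDeg + outDeg)                    ≡⟨ cong₂ _+_ oldDep≡depCount inDeg+outDeg≡q ⟩
      depCount D + q                               ∎
      where
      open ≡-Reasoning
      oldDep≡depCount : oldDep ≡ depCount D
      oldDep≡depCount = ℕₚ.≤-antisym (oldDep≤depCount one-sided) depCount≤oldDep
      1≤in+out : 1 ≤ inDeg + outDeg
      1≤in+out = subst (1 ≤_) (sym inDeg+outDeg≡q) 1≤q

    one-sided-bounds : (∀ x → ¬ In x) ⊎ (∀ x → ¬ Out x) → 1 ≤ q →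
                       depCount D + q ≤ 2 + depCount D′ × 1 + depCount D′ ≤ depCount D + q
    one-sided-bounds one-sided 1≤q =
      exact⇒bounds (depCount D) (depCount D′) q (depCount-one-sided one-sided 1≤q)

    depCount-bounds : 1 ≤ q → depCount D + q ≤ 2 + depCount D′ × 1 + depCount D′ ≤ depCount D + q
    depCount-bounds 1≤q with InOrder.maximum | OutOrder.maximum
    ... | inj₁ no-in | _           = one-sided-bounds (inj₁ no-in) 1≤q
    ... | inj₂ _     | inj₁ no-out = one-sided-bounds (inj₂ no-out) 1≤q
    ... | inj₂ (last , lastIn) | inj₂ (first , firstOut) =
      subst (λ k → depCount D + k ≤ 2 + depCount D′ × 1 + depCount D′ ≤ depCount D + k) inDeg+outDeg≡q
            (subst (λ k → depCount D + (inDeg + outDeg) ≤ 2 + k × 1 + k ≤ depCount D + (inDeg + outDeg))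
                   (sym depCount-split)
                   (two-sided-count-bounds inDeg outDeg oldDep (depCount D)
                      (ℕₚ.≤-trans (indicator≥1 (in? last) (proj₁ lastIn)) (≤-sum _ last))
                      (ℕₚ.≤-trans (indicator≥1 (out? first) (proj₁ firstOut)) (≤-sum _ first))
                      depCount≤oldDep (oldDep≤1+depCount lastIn firstOut)))

  nonempty⇒1≤q : ∃ (_∈ Q) → 1 ≤ q
  nonempty⇒1≤q (u , u∈Q) =
    ℕₚ.≤-trans (indicator≥1 (Vec.lookup Q u Boolₚ.≟ true) (Vecₚ.[]=⇒lookup u∈Q)) (≤-sum _ u)

  module _ (1≤q : 1 ≤ q) where

    restrict-achieves : ∀ {k′} → Achieves G′ k′ →
                        ∃[ k ] Achieves G k × k + q ≤ 2 + k′ × 1 + k′ ≤ k + q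
    restrict-achieves (D′ , acyc′ , numDep′) rewrite numDep⇒≡depCount numDep′ =
      depCount D , (D , acyc , numDep-depCount D) , depCount-bounds 1≤q
      where open Analysis D′ acyc′

    extend-achieves : ∀ {k d} → k + q ≡ 1 + d → Achieves G k → Achieves G′ d
    extend-achieves {k} k+q≡1+d (D , acyc , numDep) = D′ , acyc′ , subst (NumDep D′) d′≡d (numDep-depCount D′)
      where
      D′ : Orientation G′
      D′ = extend D
      acyc′ : Acyclic D′
      acyc′ = extend-acyclic acyc
      open Analysis D′ acyc′ using (depCount-one-sided)
      k≡restricted : k ≡ depCount (restrict D′)
      k≡restricted = numDep⇒≡depCount (numDep-sameDir (sameDir-sym (restrict-extend D)) numDep)
      d′≡d : depCount D′ ≡ _
      d′≡d = ℕₚ.suc-injective (trans (depCount-one-sided (inj₁ (λ _ ())) 1≤q)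
                                     (trans (cong (_+ q) (sym k≡restricted)) k+q≡1+d))

    dmin-shift : ∀ {m k′} → IsDmin G m → Achieves G′ k′ → m + q ≤ 2 + k′
    dmin-shift (_ , least) achieves′ with restrict-achieves achieves′
    ... | k , achieves , k+q≤2+k′ , _ = ℕₚ.≤-trans (ℕₚ.+-monoˡ-≤ q (least k achieves)) k+q≤2+k′

    dmax-shift : ∀ {M k′} → IsDmax G M → Achieves G′ k′ → 1 + k′ ≤ M + q
    dmax-shift (_ , greatest) achieves′ with restrict-achieves achieves′
    ... | k , achieves , _ , 1+k′≤k+q = ℕₚ.≤-trans 1+k′≤k+q (ℕₚ.+-monoˡ-≤ q (greatest k achieves))

corollary3 : ∀ {n} (G : Graph n) (Q : Subset n) → IsClique G Q → ∃ (λ u → u ∈ Q) →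
    FullyOrientable G → FullyOrientable (addVertex G Q)
corollary3 G Q clique nonempty fully m′ M′ (achieves-m′ , _) (achieves-M′ , _) d m′≤d d≤M′ with m′ ℕ.≟ d
... | yes refl = achieves-m′
... | no m′≢d with dmin-exists {G = G} | dmax-exists {G = G}
...   | m , m-min | M , M-max = extend-achieves 1≤q k+q≡1+d (fully m M m-min M-max k m≤k k≤M)
  where
  open Extension G Q clique
  1≤q : 1 ≤ q
  1≤q = nonempty⇒1≤q nonempty
  m+q≤1+d : m + q ≤ 1 + d
  m+q≤1+d = ℕₚ.≤-trans (dmin-shift 1≤q m-min achieves-m′) (s≤s (ℕₚ.≤∧≢⇒< m′≤d m′≢d))
  1+d≤M+q : 1 + d ≤ M + q
  1+d≤M+q = ℕₚ.≤-trans (s≤s d≤M′) (dmax-shift 1≤q M-max achieves-M′)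
  k : ℕ
  k = 1 + d ∸ q
  m≤k : m ≤ k
  m≤k = ℕₚ.m+n≤o⇒m≤o∸n m m+q≤1+d
  k≤M : k ≤ M
  k≤M = ℕₚ.≤-trans (ℕₚ.∸-monoˡ-≤ q 1+d≤M+q) (ℕₚ.≤-reflexive (ℕₚ.m+n∸n≡m M q))
  k+q≡1+d : k + q ≡ 1 + d
  k+q≡1+d = ℕₚ.m∸n+n≡m (ℕₚ.m+n≤o⇒n≤o m m+q≤1+d)
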